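{- Let $n$ be odd with $2n+1$ prime, and let $g$ be a primitive root modulo $2n+1$. For $i = 1, 2, \ldots, n$ let $c_i \in \mathbb{Z}_{2n}$ be the discrete logarithm of $i$ to base $g$ (i.e. $g^{c_i} \equiv i \pmod{2n+1}$), and let $d_i \in \mathbb{Z}_n$ be the reduction of $c_i$ modulo $n$. Then $(d_1, d_2, \ldots, d_n)$ is an ODC-starter for $\mathbb{Z}_n$.
   Context: Write $n = 2m+1$ and view the vertices of $K_n$ as the elements of the cyclic group $\mathbb{Z}_n=\{0,1,\dots,n-1\}$. The length of the edge between vertices $x$ and $y$ is the set $\{y-x, x-y\} = \pm(y-x)$. A Hamiltonian path in $K_n$ (equivalently, an arrangement $(h_1,\dots,h_n)$ of all elements of $\mathbb{Z}_n$, with edges $\{h_t,h_{t+1}\}$) is a terrace for $\mathbb{Z}_n$ if each edge length $\pm \ell$, for $\ell \in \{1, 2, \ldots, m\}$, occurs exactly twice among its edges. The distance between two edges $\{x_1,y_1\}$ and $\{x_2,y_2\}$ of the same length is $\pm k$ if either $\{x_1+k, y_1+k\} = \{x_2,y_2\}$ or $\{x_1-k,y_1-k\}=\{x_2,y_2\}$. A terrace is an ODC-starter for $\mathbb{Z}_n$ if every distance $\pm k$, for $k \in \{1, 2, \ldots, m\}$, occurs as the distance between the two edges of some common length $\pm\ell$. -}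

module Defs where

open import Data.Nat using (ℕ; zero; suc; _+_; _*_; _∸_; _^_; _≤_; _<_; _≡ᵇ_; NonZero)
open import Data.Nat.DivMod using (_%_)
open import Data.Bool using (Bool; true; false; _∨_; if_then_else_)
open import Data.Product using (_×_; ∃; ∃-syntax; _,_)
open import Data.Sum using (_⊎_)
open import Relation.Binary.PropositionalEquality using (_≡_; _≢_)

-- Throughout, n = N m = 2m+1 and the elements of ℤ_n are represented by the
-- naturals 0,1,…,n-1.
N : ℕ → ℕ
N m = suc (2 * m)

dif : ℕ → ℕ → ℕ → ℕ
dif m x y = (y + (N m ∸ x)) % N m

shiftUp : ℕ → ℕ → ℕ → ℕ
shiftUp m k x = (x + k) % N m

shiftDown : ℕ → ℕ → ℕ → ℕ
shiftDown m k x = (x + (N m ∸ k)) % N m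

HasLen : ℕ → ℕ → ℕ → ℕ → Set
HasLen m x y ℓ = (dif m x y ≡ ℓ) ⊎ (dif m y x ≡ ℓ)

isLen : ℕ → ℕ → ℕ → ℕ → Bool
isLen m x y ℓ = (dif m x y ≡ᵇ ℓ) ∨ (dif m y x ≡ᵇ ℓ)

count : (ℕ → Bool) → ℕ → ℕ
count P zero = 0
count P (suc k) = (if P k then 1 else 0) + count P k

SamePair : ℕ → ℕ → ℕ → ℕ → Set
SamePair a b c d = (a ≡ c × b ≡ d) ⊎ (a ≡ d × b ≡ c)

DistIs : ℕ → ℕ → ℕ → ℕ → ℕ → ℕ → Set
DistIs m k x₁ y₁ x₂ y₂ =
  SamePair (shiftUp m k x₁) (shiftUp m k y₁) x₂ y₂
  ⊎ SamePair (shiftDown m k x₁) (shiftDown m k y₁) x₂ y₂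

-- h t (t = 0,…,n-1) is an arrangement of all elements of ℤ_n
-- (paper's (h_1,…,h_n) is h 0, …, h (n-1)); edges are {h t, h (t+1)}, t < 2m.
Arrangement : ℕ → (ℕ → ℕ) → Set
Arrangement m h =
  (∀ t → t < N m → h t < N m)
  × (∀ x → x < N m → ∃[ t ] (t < N m × h t ≡ x))
  × (∀ s t → s < N m → t < N m → h s ≡ h t → s ≡ t)

Terrace : ℕ → (ℕ → ℕ) → Set
Terrace m h =
  Arrangement m h
  × (∀ ℓ → 1 ≤ ℓ → ℓ ≤ m → count (λ t → isLen m (h t) (h (suc t)) ℓ) (2 * m) ≡ 2)

ODCStarter : ℕ → (ℕ → ℕ) → Set
ODCStarter m h =
  Terrace m h
  × (∀ k → 1 ≤ k → k ≤ m →
       ∃[ ℓ ] ∃[ s ] ∃[ t ]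
         (1 ≤ ℓ × ℓ ≤ m × s < 2 * m × t < 2 * m × s ≢ t
          × HasLen m (h s) (h (suc s)) ℓ × HasLen m (h t) (h (suc t)) ℓ
          × DistIs m k (h s) (h (suc s)) (h t) (h (suc t))))

PrimitiveRoot : (p : ℕ) .{{_ : NonZero p}} → ℕ → Set
PrimitiveRoot p g =
  (g ^ (p ∸ 1)) % p ≡ 1 % p
  × (∀ k → 1 ≤ k → k < p ∸ 1 → (g ^ k) % p ≢ 1 % p)

module Submission where

-- Let p = 2n + 1 and G e = g^e mod p. As g has order 2n, G n ≡ -1, so G a ≡ ±G b exactly when
-- a ≡ b (mod n). Since {1, …, n} meets every class {±u} of units once, i ↦ d_i is a bijection
-- onto ℤ_n, and d_a - d_b ≡ e (mod n) iff a ≡ ±g^e b (mod p).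
-- Hence the edge {d_i, d_(i+1)} has length ±ℓ iff (i + 1)/i or i/(i + 1) is ±g^ℓ. For
-- v ∉ {0, ±1} exactly one i ∈ [1, n) has (i + 1)/i = v or i/(i + 1) = v: the root
-- x = 1/(v - 1) of 1 + x = v x, or its reflection p - 1 - x. Taking v = ±g^ℓ yields two
-- edges of length ±ℓ, distinct because g^(2ℓ) ≢ -1 when 2ℓ < n.
-- For a distance k let 2i + 1 be the odd one of ±g^k mod p. The solution z of
-- (2i + 1) z ≡ -i satisfies (2i + 1)(z + 1) ≡ i + 1, so the edges at i and at z (or at the
-- reflection of z) are translates of each other by k in ℤ_n.

open import Data.Integer.Base using (ℤ; +_)
open import Data.Nat.Base as ℕ using (ℕ; suc; NonZero; _≤_; _<_; _^_)
open import Data.Nat.DivMod using (_%_)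
open import Data.Product.Base using (_×_; _,_)
open import Relation.Binary.PropositionalEquality using (_≡_)
open import Data.Nat.Primality using (Prime)
open import Defs using (N; PrimitiveRoot; ODCStarter)

module Counting where
  open import Data.Bool.Base using (true; false; T)
  open import Data.Nat.Base using (suc; _+_; _≤_; _<_; z≤n; _≤′_; ≤′-refl; ≤′-step)
  open import Data.Nat.Properties
  open import Data.Sum.Base using (_⊎_; [_,_]′; swap)
  open import Function.Base using (_∘_)
  open import Relation.Binary.Definitions using (tri<; tri≈; tri>)
  open import Relation.Binary.PropositionalEquality
  open import Relation.Nullary using (¬_; contradiction)
  open import Defs using (count)

  count-suc : ∀ P {t} → T (P t) → count P (suc t) ≡ suc (count P t)
  count-suc P {t} Pt with P t | Pt
  ... | true | _ = refl

  count-unchanged′ : ∀ P {j K} → j ≤′ K → (∀ t → j ≤ t → t < K → ¬ T (P t)) → count P K ≡ count P j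
  count-unchanged′ P ≤′-refl _ = refl
  count-unchanged′ P (≤′-step {K} j≤′K) never with P K | never K (≤′⇒≤ j≤′K) (n<1+n K)
  ... | true  | ¬PK = contradiction _ ¬PK
  ... | false | _   = count-unchanged′ P j≤′K (λ t j≤t t<K → never t j≤t (m<n⇒m<1+n t<K))

  count-unchanged : ∀ P {j K} → j ≤ K → (∀ t → j ≤ t → t < K → ¬ T (P t)) → count P K ≡ count P j
  count-unchanged P = count-unchanged′ P ∘ ≤⇒≤′

  count-two< : ∀ P {K a b} → a < b → b < K → T (P a) → T (P b) →
               (∀ t → t < K → T (P t) → t ≡ a ⊎ t ≡ b) → count P K ≡ 2
  count-two< P {K} {a} {b} a<b b<K Pa Pb only = begin
    count P K              ≡⟨ count-unchanged P b<K above ⟩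
    count P (suc b)        ≡⟨ count-suc P Pb ⟩
    suc (count P b)        ≡⟨ cong suc (count-unchanged P a<b between) ⟩
    suc (count P (suc a))  ≡⟨ cong suc (count-suc P Pa) ⟩
    2 + count P a          ≡⟨ cong (λ k → 2 + k) (count-unchanged P z≤n below) ⟩
    2                      ∎
    where
    open ≡-Reasoning
    excluded : ∀ {t} → t < K → t ≢ a → t ≢ b → ¬ T (P t)
    excluded t<K t≢a t≢b Pt = [ t≢a , t≢b ]′ (only _ t<K Pt)
    above : ∀ t → suc b ≤ t → t < K → ¬ T (P t)
    above t b<t t<K = excluded t<K (>⇒≢ (<-trans a<b b<t)) (>⇒≢ b<t)
    between : ∀ t → suc a ≤ t → t < b → ¬ T (P t)
    between t a<t t<b = excluded (<-trans t<b b<K) (>⇒≢ a<t) (<⇒≢ t<b)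
    below : ∀ t → 0 ≤ t → t < a → ¬ T (P t)
    below t _ t<a = excluded (<-trans t<a (<-trans a<b b<K)) (<⇒≢ t<a) (<⇒≢ (<-trans t<a a<b))

  count-two : ∀ P {K a b} → a ≢ b → a < K → b < K → T (P a) → T (P b) →
              (∀ t → t < K → T (P t) → t ≡ a ⊎ t ≡ b) → count P K ≡ 2
  count-two P {a = a} {b} a≢b a<K b<K Pa Pb only with <-cmp a b
  ... | tri< a<b _ _ = count-two< P a<b b<K Pa Pb only
  ... | tri≈ _ a≡b _ = contradiction a≡b a≢b
  ... | tri> _ _ b<a = count-two< P b<a a<K Pb Pa (λ t t<K Pt → swap (only t t<K Pt))

module IntegerCongruence (Q : ℤ) where
  open import Data.Integer.Base using (-_; _+_; _*_; _-_)
  open import Data.Integer.Properties using (neg-involutive; neg-distribˡ-*)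
  open import Data.Integer.Tactic.RingSolver using (solve)
  open import Data.List.Base using (_∷_; [])
  open import Data.Product.Base using (_×_; _,_)
  open import Data.Sum.Base using (_⊎_; inj₁; inj₂)
  open import Level using (0ℓ)
  open import Relation.Binary.Bundles using (Setoid)
  open import Relation.Binary.PropositionalEquality
  import Relation.Binary.Reasoning.Setoid as SetoidReasoning

  infix 4 _≈_ _≈±_
  infix 0 _by_

  record _≈_ (x y : ℤ) : Set where
    constructor _by_
    field
      multiple : ℤ
      eq       : x ≡ y + multiple * Q

  ≈-refl : ∀ {x} → x ≈ x
  ≈-refl {x} = + 0 by solve (x ∷ Q ∷ [])

  ≡⇒≈ : ∀ {x y} → x ≡ y → x ≈ y
  ≡⇒≈ refl = ≈-refl

  -- Unlike its siblings, ≈-sym does not match on the equation, so that the multiple of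
  -- ≈-sym (k by e) is - k definitionally; residue-unique relies on this.
  ≈-sym : ∀ {x y} → x ≈ y → y ≈ x
  ≈-sym {x} {y} (k by x≡y+kQ) = - k by begin
    y                  ≡⟨ solve (y ∷ k ∷ Q ∷ []) ⟩
    y + k * Q - k * Q  ≡⟨ cong (_+ - (k * Q)) (sym x≡y+kQ) ⟩
    x - k * Q          ≡⟨ cong (_+_ x) (neg-distribˡ-* k Q) ⟩
    x + - k * Q        ∎
    where open ≡-Reasoning

  ≈-trans : ∀ {x y z} → x ≈ y → y ≈ z → x ≈ z
  ≈-trans {z = z} (k by refl) (l by refl) = l + k by solve (z ∷ k ∷ l ∷ Q ∷ [])

  ≈-setoid : Setoid 0ℓ 0ℓ
  ≈-setoid = record
    { Carrier       = ℤ
    ; _≈_           = _≈_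
    ; isEquivalence = record { refl = ≈-refl ; sym = ≈-sym ; trans = ≈-trans }
    }

  module ≈-Reasoning = SetoidReasoning ≈-setoid

  +-cong : ∀ {x y u v} → x ≈ y → u ≈ v → x + u ≈ y + v
  +-cong {y = y} {v = v} (k by refl) (l by refl) = k + l by solve (y ∷ v ∷ k ∷ l ∷ Q ∷ [])

  *-cong : ∀ {x y u v} → x ≈ y → u ≈ v → x * u ≈ y * v
  *-cong {y = y} {v = v} (k by refl) (l by refl) =
    k * v + y * l + k * l * Q by solve (y ∷ v ∷ k ∷ l ∷ Q ∷ [])

  *-congˡ : ∀ z {x y} → x ≈ y → z * x ≈ z * y
  *-congˡ z = *-cong (≈-refl {z})

  *-congʳ : ∀ z {x y} → x ≈ y → x * z ≈ y * z
  *-congʳ z x≈y = *-cong x≈y (≈-refl {z})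

  -‿cong : ∀ {x y} → x ≈ y → - x ≈ - y
  -‿cong {y = y} (k by refl) = - k by solve (y ∷ k ∷ Q ∷ [])

  Q≈0 : Q ≈ + 0
  Q≈0 = + 1 by solve (Q ∷ [])

  x-y≈0⇒x≈y : ∀ {x y} → x - y ≈ + 0 → x ≈ y
  x-y≈0⇒x≈y {x} {y} x-y≈0 = begin
    x            ≡⟨ solve (x ∷ y ∷ []) ⟩
    x - y + y    ≈⟨ +-cong x-y≈0 ≈-refl ⟩
    + 0 + y      ≡⟨ solve (y ∷ []) ⟩
    y            ∎
    where open ≈-Reasoning

  x≈y⇒x-y≈0 : ∀ {x y} → x ≈ y → x - y ≈ + 0
  x≈y⇒x-y≈0 {x} {y} x≈y = begin
    x - y    ≈⟨ +-cong x≈y ≈-refl ⟩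
    y - y    ≡⟨ solve (y ∷ []) ⟩
    + 0      ∎
    where open ≈-Reasoning

  x+y≈0⇒x≈-y : ∀ {x y} → x + y ≈ + 0 → x ≈ - y
  x+y≈0⇒x≈-y {x} {y} x+y≈0 = x-y≈0⇒x≈y (subst (_≈ + 0) (cong (_+_ x) (sym (neg-involutive y))) x+y≈0)

  x≈-y⇒x+y≈0 : ∀ {x y} → x ≈ - y → x + y ≈ + 0
  x≈-y⇒x+y≈0 {x} {y} x≈-y = subst (_≈ + 0) (cong (_+_ x) (neg-involutive y)) (x≈y⇒x-y≈0 x≈-y)

  +-cancelʳ : ∀ z {x y} → x + z ≈ y + z → x ≈ y
  +-cancelʳ z {x} {y} x+z≈y+z = begin
    x              ≡⟨ solve (x ∷ z ∷ []) ⟩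
    x + z - z      ≈⟨ +-cong x+z≈y+z ≈-refl ⟩
    y + z - z      ≡⟨ solve (y ∷ z ∷ []) ⟩
    y              ∎
    where open ≈-Reasoning

  DiffersBy : ℤ → ℤ → ℤ → Set
  DiffersBy x y l = y ≈ x + l ⊎ x ≈ y + l

  ShiftedBy : ℤ → ℤ → ℤ → ℤ → ℤ → Set
  ShiftedBy k x y x′ y′ = (x ≈ x′ + k × y ≈ y′ + k) ⊎ (x ≈ y′ + k × y ≈ x′ + k)

  translate-difference : ∀ k x′ {x y y′ l} → x ≈ x′ + k → y ≈ y′ + k → y ≈ x + l → y′ ≈ x′ + l
  translate-difference k x′ {x} {y} {y′} {l} x≈x′+k y≈y′+k y≈x+l = +-cancelʳ k (begin
    y′ + k          ≈⟨ ≈-sym y≈y′+k ⟩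
    y               ≈⟨ y≈x+l ⟩
    x + l           ≈⟨ +-cong x≈x′+k ≈-refl ⟩
    x′ + k + l      ≡⟨ solve (k ∷ x′ ∷ l ∷ []) ⟩
    x′ + l + k      ∎)
    where open ≈-Reasoning

  differsBy-shifted : ∀ {k x y x′ y′ l} → ShiftedBy k x y x′ y′ → DiffersBy x y l → DiffersBy x′ y′ l
  differsBy-shifted {k} {x′ = x′} {y′} (inj₁ (x≈ , y≈)) (inj₁ y≈x+l) = inj₁ (translate-difference k x′ x≈ y≈ y≈x+l)
  differsBy-shifted {k} {x′ = x′} {y′} (inj₁ (x≈ , y≈)) (inj₂ x≈y+l) = inj₂ (translate-difference k y′ y≈ x≈ x≈y+l)
  differsBy-shifted {k} {x′ = x′} {y′} (inj₂ (x≈ , y≈)) (inj₁ y≈x+l) = inj₂ (translate-difference k y′ x≈ y≈ y≈x+l)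
  differsBy-shifted {k} {x′ = x′} {y′} (inj₂ (x≈ , y≈)) (inj₂ x≈y+l) = inj₁ (translate-difference k x′ y≈ x≈ x≈y+l)

  _≈±_ : ℤ → ℤ → Set
  x ≈± y = x ≈ y ⊎ x ≈ - y

  ≈±-sym : ∀ {x y} → x ≈± y → y ≈± x
  ≈±-sym (inj₁ x≈y) = inj₁ (≈-sym x≈y)
  ≈±-sym {x} {y} (inj₂ x≈-y) = inj₂ (≈-trans (≡⇒≈ (sym (neg-involutive y))) (-‿cong (≈-sym x≈-y)))

  ≈±-trans : ∀ {x y z} → x ≈± y → y ≈± z → x ≈± z
  ≈±-trans (inj₁ x≈y) (inj₁ y≈z) = inj₁ (≈-trans x≈y y≈z)
  ≈±-trans (inj₁ x≈y) (inj₂ y≈-z) = inj₂ (≈-trans x≈y y≈-z)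
  ≈±-trans (inj₂ x≈-y) (inj₁ y≈z) = inj₂ (≈-trans x≈-y (-‿cong y≈z))
  ≈±-trans {z = z} (inj₂ x≈-y) (inj₂ y≈-z) =
    inj₁ (≈-trans x≈-y (≈-trans (-‿cong y≈-z) (≡⇒≈ (neg-involutive z))))

  ≈±-*-cong : ∀ {x y u v} → x ≈± y → u ≈± v → x * u ≈± y * v
  ≈±-*-cong (inj₁ x≈y) (inj₁ u≈v) = inj₁ (*-cong x≈y u≈v)
  ≈±-*-cong {y = y} {v = v} (inj₁ x≈y) (inj₂ u≈-v) =
    inj₂ (≈-trans (*-cong x≈y u≈-v) (≡⇒≈ (solve (y ∷ v ∷ []))))
  ≈±-*-cong {y = y} {v = v} (inj₂ x≈-y) (inj₁ u≈v) =
    inj₂ (≈-trans (*-cong x≈-y u≈v) (≡⇒≈ (solve (y ∷ v ∷ []))))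
  ≈±-*-cong {y = y} {v = v} (inj₂ x≈-y) (inj₂ u≈-v) =
    inj₁ (≈-trans (*-cong x≈-y u≈-v) (≡⇒≈ (solve (y ∷ v ∷ []))))

  ≈±-square : ∀ {x y} → x ≈± y → x * x ≈ y * y
  ≈±-square (inj₁ x≈y)  = *-cong x≈y x≈y
  ≈±-square {y = y} (inj₂ x≈-y) = ≈-trans (*-cong x≈-y x≈-y) (≡⇒≈ (solve (y ∷ [])))

module Residues (q : ℕ) .{{_ : NonZero q}} where
  open import Data.Integer.Base using (+_; -[1+_]; _+_; _*_)
  open import Data.Integer.DivMod using (_%ℕ_; _/ℕ_; n%ℕd<d; a≡a%ℕn+[a/ℕn]*n)
  open import Data.Integer.Properties using (+-injective; +-identityˡ; +-identityʳ; pos-+; pos-*)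
  open import Data.Nat.Base as ℕ using (zero; suc; _≤_; _<_)
  open import Data.Nat.DivMod using (_%_; _/_; m%n<n; m≡m%n+[m/n]*n)
  open import Data.Nat.Properties using (≤-trans; m≤m+n; m≤n+m; <⇒≱; <⇒≢; <-trans)
  open import Data.Product.Base using (∃-syntax; _×_; _,_)
  open import Relation.Binary.PropositionalEquality
  open import Relation.Nullary using (¬_; Dec; yes; no; contradiction)

  open IntegerCongruence (+ q) public

  pos-+-* : ∀ a b c → + (a ℕ.+ b ℕ.* c) ≡ + a + + b * + c
  pos-+-* a b c = trans (pos-+ a (b ℕ.* c)) (cong (_+_ (+ a)) (pos-* b c))

  ≈-% : ∀ a → + a ≈ + (a % q)
  ≈-% a = + (a / q) by trans (cong +_ (m≡m%n+[m/n]*n a q)) (pos-+-* (a % q) (a / q) q)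

  positive-multiple⇒q≤ : ∀ {a b} j → + a ≡ + b + + suc j * + q → q ≤ a
  positive-multiple⇒q≤ {a} {b} j eq = subst (q ≤_) (sym a≡b+[1+j]q) (≤-trans (m≤m+n q (j ℕ.* q)) (m≤n+m _ b))
    where
    a≡b+[1+j]q : a ≡ b ℕ.+ suc j ℕ.* q
    a≡b+[1+j]q = +-injective (trans eq (sym (pos-+-* b (suc j) q)))

  residue-unique : ∀ {a b} → a < q → b < q → + a ≈ + b → a ≡ b
  residue-unique a<q b<q (+ zero by eq) = +-injective (trans eq (+-identityʳ _))
  residue-unique a<q b<q (+ suc j by eq) = contradiction (positive-multiple⇒q≤ j eq) (<⇒≱ a<q)
  residue-unique a<q b<q a≈b@(-[1+ j ] by _) =
    contradiction (positive-multiple⇒q≤ j (_≈_.eq (≈-sym a≈b))) (<⇒≱ b<q)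

  ≈⇒%≡ : ∀ {a b} → + a ≈ + b → a % q ≡ b % q
  ≈⇒%≡ {a} {b} a≈b =
    residue-unique (m%n<n a q) (m%n<n b q) (≈-trans (≈-sym (≈-% a)) (≈-trans a≈b (≈-% b)))

  %≡⇒≈ : ∀ {a b} → a % q ≡ b % q → + a ≈ + b
  %≡⇒≈ {a} {b} a%q≡b%q = ≈-trans (≈-% a) (≈-trans (≡⇒≈ (cong +_ a%q≡b%q)) (≈-sym (≈-% b)))

  multiple≈0 : ∀ a → + (a ℕ.* q) ≈ + 0
  multiple≈0 a = + a by trans (pos-* a q) (sym (+-identityˡ _))

  residue : ∀ x → ∃[ r ] (r < q × x ≈ + r)
  residue x = x %ℕ q , n%ℕd<d x q , (x /ℕ q by a≡a%ℕn+[a/ℕn]*n x q)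

  +≉0 : ∀ {a} → 0 < a → a < q → ¬ + a ≈ + 0
  +≉0 0<a a<q a≈0 = <⇒≢ 0<a (sym (residue-unique a<q (<-trans 0<a a<q) a≈0))

  ≈0? : ∀ x → Dec (x ≈ + 0)
  ≈0? x with residue x
  ... | zero  , _   , x≈0 = yes x≈0
  ... | suc r , r<q , x≈r = no (λ x≈0 → +≉0 (ℕ.s≤s ℕ.z≤n) r<q (≈-trans (≈-sym x≈r) x≈0))


module PrimeField (p : ℕ) .{{_ : NonZero p}} (prime : Prime p) where
  open import Data.Integer.Base using (-_; _+_; _*_; _-_)
  open import Data.Integer.Properties using (pos-*; neg-distribʳ-*; -1*i≡-i; *-comm; *-identityˡ; *-zeroʳ)
  open import Data.Integer.Tactic.RingSolver using (solve)
  open import Data.List.Base using (_∷_; [])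
  open import Data.Nat.Base as ℕ using (suc; _<_)
  open import Data.Nat.Coprimality using (prime⇒coprime; coprime-Bézout)
  open import Data.Nat.GCD using (module Bézout)
  import Data.Nat.Properties as ℕP
  open import Data.Product.Base using (∃-syntax; _×_; _,_; map₂)
  open import Data.Sum.Base using (_⊎_; inj₁; inj₂; [_,_]′)
  open import Relation.Binary.PropositionalEquality
  open import Relation.Nullary using (¬_; yes; no; contradiction)

  open Residues p
  open ≈-Reasoning

  inverse : ∀ {x} → ¬ x ≈ + 0 → ∃[ y ] x * y ≈ + 1
  inverse {x} x≉0 with residue x
  ... | ℕ.zero , _ , x≈0 = contradiction x≈0 x≉0
  ... | r@(suc _) , r<p , x≈r =
    map₂ (≈-trans (*-congʳ _ x≈r)) (inverse-from-Bézout (coprime-Bézout (prime⇒coprime prime r<p)))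
    where
    inverse-from-Bézout : Bézout.Identity 1 p r → ∃[ y ] + r * y ≈ + 1
    inverse-from-Bézout (Bézout.-+ a b 1+ap≡br) = + b , (begin
      + r * + b            ≡⟨ sym (pos-* r b) ⟩
      + (r ℕ.* b)          ≡⟨ cong +_ (trans (ℕP.*-comm r b) (sym 1+ap≡br)) ⟩
      + 1 + + (a ℕ.* p)    ≈⟨ +-cong (≈-refl {+ 1}) (multiple≈0 a) ⟩
      + 1                  ∎)
    inverse-from-Bézout (Bézout.+- a b 1+br≡ap) = - + b , (begin
      + r * - + b          ≡⟨ neg-distribʳ-* (+ r) (+ b) ⟨
      - (+ r * + b)        ≈⟨ ≈-sym (x+y≈0⇒x≈-y 1+rb≈0) ⟩
      + 1                  ∎)
      where
      1+rb≈0 : + 1 + + r * + b ≈ + 0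
      1+rb≈0 = begin
        + 1 + + r * + b      ≡⟨ cong (_+_ (+ 1)) (sym (pos-* r b)) ⟩
        + (1 ℕ.+ r ℕ.* b)    ≡⟨ cong (λ t → + (1 ℕ.+ t)) (ℕP.*-comm r b) ⟩
        + (1 ℕ.+ b ℕ.* r)    ≡⟨ cong +_ 1+br≡ap ⟩
        + (a ℕ.* p)          ≈⟨ multiple≈0 a ⟩
        + 0                  ∎

  *-cancelˡ : ∀ {a x y} → ¬ a ≈ + 0 → a * x ≈ a * y → x ≈ y
  *-cancelˡ {a} {x} {y} a≉0 ax≈ay with inverse a≉0
  ... | u , au≈1 = begin
    x              ≡⟨ *-identityˡ x ⟨
    + 1 * x        ≈⟨ *-congʳ x (≈-sym au≈1) ⟩
    a * u * x      ≡⟨ solve (a ∷ u ∷ x ∷ []) ⟩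
    u * (a * x)    ≈⟨ *-congˡ u ax≈ay ⟩
    u * (a * y)    ≡⟨ solve (a ∷ u ∷ y ∷ []) ⟩
    a * u * y      ≈⟨ *-congʳ y au≈1 ⟩
    + 1 * y        ≡⟨ *-identityˡ y ⟩
    y              ∎

  *-cancelʳ : ∀ {a x y} → ¬ a ≈ + 0 → x * a ≈ y * a → x ≈ y
  *-cancelʳ {a} {x} {y} a≉0 xa≈ya =
    *-cancelˡ a≉0 (≈-trans (≡⇒≈ (*-comm a x)) (≈-trans xa≈ya (≡⇒≈ (*-comm y a))))

  *≈-⇒≈-1 : ∀ {a x} → ¬ x ≈ + 0 → a * x ≈ - x → a ≈ - + 1
  *≈-⇒≈-1 {a} {x} x≉0 ax≈-x = *-cancelʳ x≉0 (≈-trans ax≈-x (≡⇒≈ (sym (-1*i≡-i x))))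

  zero-product : ∀ {x y} → x * y ≈ + 0 → x ≈ + 0 ⊎ y ≈ + 0
  zero-product {x} {y} xy≈0 with ≈0? x
  ... | yes x≈0 = inj₁ x≈0
  ... | no  x≉0 = inj₂ (*-cancelˡ x≉0 (≈-trans xy≈0 (≡⇒≈ (sym (*-zeroʳ x)))))

  *-≉0 : ∀ {x y} → ¬ x ≈ + 0 → ¬ y ≈ + 0 → ¬ x * y ≈ + 0
  *-≉0 x≉0 y≉0 xy≈0 = [ x≉0 , y≉0 ]′ (zero-product xy≈0)

  linear-solution : ∀ {a} → ¬ a ≈ + 0 → ∀ b → ∃[ z ] (z < p × a * + z ≈ b)
  linear-solution {a} a≉0 b with inverse a≉0
  ... | u , au≈1 with residue (u * b)
  ... | z , z<p , ub≈z = z , z<p , (begin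
    a * + z        ≈⟨ *-congˡ a (≈-sym ub≈z) ⟩
    a * (u * b)    ≡⟨ solve (a ∷ u ∷ b ∷ []) ⟩
    a * u * b      ≈⟨ *-congʳ b au≈1 ⟩
    + 1 * b        ≡⟨ *-identityˡ b ⟩
    b              ∎)

  square≈1 : ∀ {x} → x * x ≈ + 1 → x ≈± + 1
  square≈1 {x} xx≈1 with zero-product (begin
    (x - + 1) * (x + + 1)   ≡⟨ solve (x ∷ []) ⟩
    x * x - + 1             ≈⟨ x≈y⇒x-y≈0 xx≈1 ⟩
    + 0                     ∎)
  ... | inj₁ x-1≈0 = inj₁ (x-y≈0⇒x≈y x-1≈0)
  ... | inj₂ x+1≈0 = inj₂ (x+y≈0⇒x≈-y x+1≈0)

module HalfSystem (n : ℕ) .{{_ : NonZero n}} where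
  import Data.Nat.Tactic.RingSolver as ℕ-Solver
  open import Data.Integer.Base using (-_; _+_)
  open import Data.Nat.Base using (zero; _∸_; _≤_; _<_; s≤s; s≤s⁻¹; z≤n; >-nonZero⁻¹)
  open import Data.Nat.Properties
    using (m*n≢0; ≤-trans; <-trans; <⇒≤; ≰⇒>; _≤?_; m<m+n; m≤m+n; n<1+n; +-suc; +-identityʳ; +-mono-≤;
           +-comm; m+[n∸m]≡n; m∸n+n≡m; m<n⇒0<n∸m; ∸-monoʳ-<; m+n∸m≡n)
  open import Data.Product.Base using (∃-syntax; _×_; _,_)
  open import Data.Sum.Base using (inj₁; inj₂)
  open import Relation.Binary.PropositionalEquality
  open import Relation.Nullary using (¬_; yes; no; contradiction)

  p : ℕ
  p = suc (2 ℕ.* n)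

  order : ℕ
  order = 2 ℕ.* n

  instance
    order-nonZero : NonZero order
    order-nonZero = m*n≢0 2 n

  open Residues p public

  1≤n : 1 ≤ n
  1≤n = >-nonZero⁻¹ n

  n<order : n < order
  n<order = m<m+n n (≤-trans 1≤n (m≤m+n n 0))

  n<p : n < p
  n<p = <-trans n<order (n<1+n order)

  1≉0 : ¬ + 1 ≈ + 0
  1≉0 = +≉0 (s≤s z≤n) (s≤s (≤-trans 1≤n (<⇒≤ n<order)))

  sum≡p⇒≈- : ∀ {a b} → a ℕ.+ b ≡ p → + a ≈ - + b
  sum≡p⇒≈- a+b≡p = x+y≈0⇒x≈-y (≈-trans (≡⇒≈ (cong +_ a+b≡p)) Q≈0)

  reflect : ∀ {z} → z ≤ order → + (order ∸ z) ≈ - + suc z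
  reflect {z} z≤order = sum≡p⇒≈- (trans (+-suc (order ∸ z) z) (cong suc (m∸n+n≡m z≤order)))

  reflect-suc : ∀ {z} → z ≤ order → + suc (order ∸ z) ≈ - + z
  reflect-suc z≤order = sum≡p⇒≈- (cong suc (m∸n+n≡m z≤order))

  order∸n≡n : order ∸ n ≡ n
  order∸n≡n = trans (m+n∸m≡n n (n ℕ.+ 0)) (+-identityʳ n)

  n<order∸i : ∀ {i} → i < n → n < order ∸ i
  n<order∸i {i} i<n = subst (_< order ∸ i) order∸n≡n (∸-monoʳ-< i<n (<⇒≤ n<order))

  order∸z<n : ∀ {z} → n < z → z ≤ order → order ∸ z < n
  order∸z<n {z} n<z z≤order = subst (order ∸ z <_) order∸n≡n (∸-monoʳ-< n<z z≤order)

  1+n≈-n : + suc n ≈ - + n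
  1+n≈-n = sum≡p⇒≈- (cong suc (cong (n ℕ.+_) (sym (+-identityʳ n))))

  order≈-1 : + order ≈ - + 1
  order≈-1 = sum≡p⇒≈- (+-comm order 1)

  2≉0 : ¬ + 2 ≈ + 0
  2≉0 = +≉0 (s≤s z≤n) (s≤s (+-mono-≤ 1≤n (≤-trans 1≤n (m≤m+n n 0))))

  even+odd≡p : ∀ {a q} → a ℕ.+ q ≡ n → q ℕ.+ q ℕ.+ suc (a ℕ.+ a) ≡ p
  even+odd≡p {a} {q} a+q≡n = begin
    q ℕ.+ q ℕ.+ suc (a ℕ.+ a)        ≡⟨ rearrange a q ⟩
    suc (a ℕ.+ q ℕ.+ (a ℕ.+ q))      ≡⟨ cong (λ k → suc (k ℕ.+ k)) a+q≡n ⟩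
    suc (n ℕ.+ n)                    ≡⟨ cong (λ k → suc (n ℕ.+ k)) (+-identityʳ n) ⟨
    p                                ∎
    where
    open ≡-Reasoning
    rearrange : ∀ a q → q ℕ.+ q ℕ.+ suc (a ℕ.+ a) ≡ suc (a ℕ.+ q ℕ.+ (a ℕ.+ q))
    rearrange = ℕ-Solver.solve-∀

  ≈±-injective : ∀ {a b} → 1 ≤ a → a ≤ n → 1 ≤ b → b ≤ n → + a ≈± + b → a ≡ b
  ≈±-injective _ a≤n _ b≤n (inj₁ a≈b) =
    residue-unique (s≤s (≤-trans a≤n (<⇒≤ n<order))) (s≤s (≤-trans b≤n (<⇒≤ n<order))) a≈b
  ≈±-injective 1≤a a≤n _ b≤n (inj₂ a≈-b) = contradiction (x≈-y⇒x+y≈0 a≈-b)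
    (+≉0 (≤-trans 1≤a (m≤m+n _ _)) (s≤s (+-mono-≤ a≤n (≤-trans b≤n (m≤m+n n 0)))))

  ≈±-representative : ∀ {x} → ¬ x ≈ + 0 → ∃[ a ] (1 ≤ a × a ≤ n × x ≈± + a)
  ≈±-representative {x} x≉0 with residue x
  ... | zero , _ , x≈0 = contradiction x≈0 x≉0
  ... | w@(suc _) , w<p , x≈w with w ≤? n
  ...   | yes w≤n = w , s≤s z≤n , w≤n , inj₁ x≈w
  ...   | no  w≰n = p ∸ w , m<n⇒0<n∸m w<p , p∸w≤n , inj₂ (≈-trans x≈w (sum≡p⇒≈- (m+[n∸m]≡n (<⇒≤ w<p))))
    where
    p∸n≡1+n : p ∸ n ≡ suc n
    p∸n≡1+n = trans (cong (_∸ n) (trans (cong (λ k → suc (n ℕ.+ k)) (+-identityʳ n)) (sym (+-suc n n))))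
                    (m+n∸m≡n n (suc n))
    p∸w≤n : p ∸ w ≤ n
    p∸w≤n = s≤s⁻¹ (subst (p ∸ w <_) p∸n≡1+n (∸-monoʳ-< (≰⇒> w≰n) (<⇒≤ w<p)))

module SuccessorRatios (n : ℕ) .{{_ : NonZero n}} (prime : Prime (suc (2 ℕ.* n))) where
  open import Data.Empty using (⊥)
  open import Data.Integer.Base using (-_; _+_; _*_; _-_)
  open import Data.Integer.Properties using (*-assoc; *-zeroʳ; neg-distribˡ-*; neg-distribʳ-*; neg-involutive)
  open import Data.Integer.Tactic.RingSolver using (solve)
  open import Data.List.Base using (_∷_; [])
  open import Data.Nat.Base using (zero; _∸_; _≤_; _<_; s≤s; s≤s⁻¹; z≤n)
  open import Data.Nat.Properties
    using (≤-trans; <-trans; ≤-<-trans; <⇒≤; <⇒≱; ≰⇒>; >⇒≢; <⇒≢; ≤∧≢⇒<; <-cmp; ≮⇒≥; ≤-reflexive;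
           +-identityʳ; +-mono-≤; +-suc; n≢0⇒n>0; m<n⇒0<n∸m; ∸-monoʳ-<; m∸n+n≡m; m∸[m∸n]≡n; m∸n≤m; n<1+n)
  open import Data.Product using (∃!; ∃-syntax; ∃₂; _×_; _,_)
  open import Data.Sum.Base using (_⊎_; inj₁; inj₂)
  open import Function.Base using (_∘_)
  open import Function.Bundles using (_⇔_; mk⇔)
  open import Relation.Binary.Definitions using (Tri; tri<; tri≈; tri>)
  open import Relation.Binary.PropositionalEquality
  open import Relation.Nullary using (¬_; contradiction)

  open HalfSystem n
  open PrimeField p prime
  open ≈-Reasoning

  SuccRatio : ℤ → ℤ → Set
  SuccRatio v x = + 1 + x ≈ v * x ⊎ x ≈ v * (+ 1 + x)

  ≈±-ratios⇔SuccRatio : ∀ {u x} → (+ 1 + x ≈± u * x ⊎ x ≈± u * (+ 1 + x)) ⇔ (SuccRatio u x ⊎ SuccRatio (- u) x)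
  ≈±-ratios⇔SuccRatio {u} {x} = mk⇔ to from
    where
    negate : ∀ {a b} → a ≈ - (u * b) → a ≈ - u * b
    negate {b = b} a≈-[ub] = ≈-trans a≈-[ub] (≡⇒≈ (neg-distribˡ-* u b))
    unnegate : ∀ {a b} → a ≈ - u * b → a ≈ - (u * b)
    unnegate {b = b} a≈[-u]b = ≈-trans a≈[-u]b (≡⇒≈ (sym (neg-distribˡ-* u b)))
    to : (+ 1 + x ≈± u * x ⊎ x ≈± u * (+ 1 + x)) → SuccRatio u x ⊎ SuccRatio (- u) x
    to (inj₁ (inj₁ 1+x≈ux))        = inj₁ (inj₁ 1+x≈ux)
    to (inj₁ (inj₂ 1+x≈-[ux]))     = inj₂ (inj₁ (negate 1+x≈-[ux]))
    to (inj₂ (inj₁ x≈u[1+x]))      = inj₁ (inj₂ x≈u[1+x])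
    to (inj₂ (inj₂ x≈-[u[1+x]]))   = inj₂ (inj₂ (negate x≈-[u[1+x]]))
    from : SuccRatio u x ⊎ SuccRatio (- u) x → (+ 1 + x ≈± u * x ⊎ x ≈± u * (+ 1 + x))
    from (inj₁ (inj₁ 1+x≈ux))      = inj₁ (inj₁ 1+x≈ux)
    from (inj₁ (inj₂ x≈u[1+x]))    = inj₂ (inj₁ x≈u[1+x])
    from (inj₂ (inj₁ 1+x≈[-u]x))   = inj₁ (inj₂ (unnegate 1+x≈[-u]x))
    from (inj₂ (inj₂ x≈[-u][1+x])) = inj₂ (inj₂ (unnegate x≈[-u][1+x]))

  1+x≈vx⇒[v-1]x≈1 : ∀ v x → + 1 + x ≈ v * x → (v - + 1) * x ≈ + 1
  1+x≈vx⇒[v-1]x≈1 v x 1+x≈vx = begin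
    (v - + 1) * x      ≡⟨ solve (v ∷ x ∷ []) ⟩
    v * x - x          ≈⟨ +-cong (≈-sym 1+x≈vx) (≈-refl { - x}) ⟩
    + 1 + x - x        ≡⟨ solve (x ∷ []) ⟩
    + 1                ∎

  [v-1]x≈1⇒1+x≈vx : ∀ v x → (v - + 1) * x ≈ + 1 → + 1 + x ≈ v * x
  [v-1]x≈1⇒1+x≈vx v x [v-1]x≈1 = begin
    + 1 + x            ≈⟨ +-cong (≈-sym [v-1]x≈1) (≈-refl {x}) ⟩
    (v - + 1) * x + x  ≡⟨ solve (v ∷ x ∷ []) ⟩
    v * x              ∎

  -- The hypotheses on y say that y is the reflection p - 1 - x of x.

  x≈v[1+x]⇒1+y≈vy : ∀ v x {y} → y ≈ - (+ 1 + x) → + 1 + y ≈ - x → x ≈ v * (+ 1 + x) → + 1 + y ≈ v * y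
  x≈v[1+x]⇒1+y≈vy v x {y} y≈-[1+x] 1+y≈-x x≈v[1+x] = begin
    + 1 + y            ≈⟨ 1+y≈-x ⟩
    - x                ≈⟨ -‿cong x≈v[1+x] ⟩
    - (v * (+ 1 + x))  ≡⟨ neg-distribʳ-* v (+ 1 + x) ⟩
    v * - (+ 1 + x)    ≈⟨ *-congˡ v (≈-sym y≈-[1+x]) ⟩
    v * y              ∎

  1+x≈vx⇒y≈v[1+y] : ∀ v x {y} → y ≈ - (+ 1 + x) → + 1 + y ≈ - x → + 1 + x ≈ v * x → y ≈ v * (+ 1 + y)
  1+x≈vx⇒y≈v[1+y] v x {y} y≈-[1+x] 1+y≈-x 1+x≈vx = begin
    y                  ≈⟨ y≈-[1+x] ⟩
    - (+ 1 + x)        ≈⟨ -‿cong 1+x≈vx ⟩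
    - (v * x)          ≡⟨ neg-distribʳ-* v x ⟩
    v * - x            ≈⟨ *-congˡ v (≈-sym 1+y≈-x) ⟩
    v * (+ 1 + y)      ∎

  ≉±1⇒-1≉0 : ∀ {v} → ¬ v ≈± + 1 → ¬ v - + 1 ≈ + 0
  ≉±1⇒-1≉0 v≉±1 = v≉±1 ∘ inj₁ ∘ x-y≈0⇒x≈y

  UniqueSuccRatio : ℤ → Set
  UniqueSuccRatio v = ∃! _≡_ (λ i → (1 ≤ i × i < n) × SuccRatio v (+ i))

  module SuccRatioRoot {v} (v≉0 : ¬ v ≈ + 0) (v≉±1 : ¬ v ≈± + 1)
                       {z} (z<p : z < p) ([v-1]z≈1 : (v - + 1) * + z ≈ + 1) where

    1+i≈vi⇒i≡z : ∀ {i} → i < p → + suc i ≈ v * + i → i ≡ z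
    1+i≈vi⇒i≡z {i} i<p 1+i≈vi = residue-unique i<p z<p
      (*-cancelˡ (≉±1⇒-1≉0 v≉±1) (≈-trans (1+x≈vx⇒[v-1]x≈1 v (+ i) 1+i≈vi) (≈-sym [v-1]z≈1)))

    i≈v[1+i]⇒order∸i≡z : ∀ {i} → i < n → + i ≈ v * + suc i → order ∸ i ≡ z
    i≈v[1+i]⇒order∸i≡z {i} i<n i≈v[1+i] = 1+i≈vi⇒i≡z (s≤s (m∸n≤m order i))
      (x≈v[1+x]⇒1+y≈vy v (+ i) (reflect i≤order) (reflect-suc i≤order) i≈v[1+i])
      where
      i≤order : i ≤ order
      i≤order = <⇒≤ (<-trans i<n n<order)

    1+z≈vz : + suc z ≈ v * + z
    1+z≈vz = [v-1]x≈1⇒1+x≈vx v (+ z) [v-1]z≈1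

    z≢0 : z ≢ 0
    z≢0 refl = 1≉0 (≈-trans (≈-sym [v-1]z≈1) (≡⇒≈ (*-zeroʳ (v - + 1))))

    z≢n : z ≢ n
    z≢n refl = v≉±1 (inj₂ (*≈-⇒≈-1 (+≉0 1≤n n<p) (≈-trans (≈-sym 1+z≈vz) 1+n≈-n)))

    z≢order : z ≢ order
    z≢order refl = *-≉0 v≉0 (+≉0 (≤-trans 1≤n (<⇒≤ n<order)) (n<1+n order)) (≈-trans (≈-sym 1+z≈vz) Q≈0)

    unique-below : z < n → UniqueSuccRatio v
    unique-below z<n = z , ((n≢0⇒n>0 z≢0 , z<n) , inj₁ 1+z≈vz) , only-z
      where
      only-z : ∀ {i} → (1 ≤ i × i < n) × SuccRatio v (+ i) → z ≡ i
      only-z ((_ , i<n) , inj₁ 1+i≈vi) = sym (1+i≈vi⇒i≡z (<-trans i<n n<p) 1+i≈vi)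
      only-z ((_ , i<n) , inj₂ i≈v[1+i]) =
        contradiction (i≈v[1+i]⇒order∸i≡z i<n i≈v[1+i]) (>⇒≢ (<-trans z<n (n<order∸i i<n)))

    unique-above : n < z → UniqueSuccRatio v
    unique-above n<z = order ∸ z , ((m<n⇒0<n∸m z<order , order∸z<n n<z z≤order) , inj₂ j≈v[1+j]) , only-j
      where
      z≤order : z ≤ order
      z≤order = s≤s⁻¹ z<p
      z<order : z < order
      z<order = ≤∧≢⇒< z≤order z≢order
      j≈v[1+j] : + (order ∸ z) ≈ v * (+ 1 + + (order ∸ z))
      j≈v[1+j] = 1+x≈vx⇒y≈v[1+y] v (+ z) (reflect z≤order) (reflect-suc z≤order) 1+z≈vz
      only-j : ∀ {i} → (1 ≤ i × i < n) × SuccRatio v (+ i) → order ∸ z ≡ i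
      only-j ((_ , i<n) , inj₁ 1+i≈vi) =
        contradiction (1+i≈vi⇒i≡z (<-trans i<n n<p) 1+i≈vi) (<⇒≢ (<-trans i<n n<z))
      only-j {i} ((_ , i<n) , inj₂ i≈v[1+i]) =
        trans (cong (order ∸_) (sym (i≈v[1+i]⇒order∸i≡z i<n i≈v[1+i]))) (m∸[m∸n]≡n (<⇒≤ (<-trans i<n n<order)))

    unique : Tri (z < n) (z ≡ n) (n < z) → UniqueSuccRatio v
    unique (tri< z<n _ _) = unique-below z<n
    unique (tri≈ _ z≡n _) = contradiction z≡n z≢n
    unique (tri> _ _ n<z) = unique-above n<z

  SuccRatio-unique : ∀ {v} → ¬ v ≈ + 0 → ¬ v ≈± + 1 → UniqueSuccRatio v
  SuccRatio-unique {v} v≉0 v≉±1 = from-root (linear-solution (≉±1⇒-1≉0 v≉±1) (+ 1))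
    where
    from-root : ∃[ z ] (z < p × (v - + 1) * + z ≈ + 1) → UniqueSuccRatio v
    from-root (z , z<p , [v-1]z≈1) = SuccRatioRoot.unique {v} v≉0 v≉±1 {z} z<p [v-1]z≈1 (<-cmp z n)

  ≉-self-neg : ∀ {v} → ¬ v ≈ + 0 → ¬ v ≈ - v
  ≉-self-neg {v} v≉0 v≈-v = *-≉0 2≉0 v≉0 (begin
    + 2 * v     ≡⟨ solve (v ∷ []) ⟩
    v + v       ≈⟨ x≈-y⇒x+y≈0 v≈-v ⟩
    + 0         ∎)

  SuccRatio-disjoint : ∀ {v x} → ¬ v ≈ + 0 → ¬ v * v ≈ - + 1 → ¬ x ≈ + 0 → ¬ + 1 + x ≈ + 0 →
                       SuccRatio v x → SuccRatio (- v) x → ⊥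
  SuccRatio-disjoint {v} {x} v≉0 _ x≉0 _ (inj₁ 1+x≈vx) (inj₁ 1+x≈[-v]x) =
    ≉-self-neg v≉0 (*-cancelʳ x≉0 (≈-trans (≈-sym 1+x≈vx) (≈-trans 1+x≈[-v]x (≡⇒≈ (solve (v ∷ x ∷ []))))))
  SuccRatio-disjoint {v} {x} v≉0 _ _ 1+x≉0 (inj₂ x≈v[1+x]) (inj₂ x≈[-v][1+x]) =
    ≉-self-neg v≉0 (*-cancelʳ 1+x≉0 (≈-trans (≈-sym x≈v[1+x]) (≈-trans x≈[-v][1+x] (≡⇒≈ (solve (v ∷ x ∷ []))))))
  SuccRatio-disjoint {v} {x} _ v²≉-1 x≉0 _ (inj₁ 1+x≈vx) (inj₂ x≈[-v][1+x]) = v²≉-1 (*≈-⇒≈-1 x≉0 (begin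
    v * v * x                ≡⟨ solve (v ∷ x ∷ []) ⟩
    v * (v * x)              ≈⟨ *-congˡ v (≈-sym 1+x≈vx) ⟩
    v * (+ 1 + x)            ≡⟨ solve (v ∷ x ∷ []) ⟩
    - (- v * (+ 1 + x))      ≈⟨ -‿cong (≈-sym x≈[-v][1+x]) ⟩
    - x                      ∎))
  SuccRatio-disjoint {v} {x} _ v²≉-1 x≉0 _ (inj₂ x≈v[1+x]) (inj₁ 1+x≈[-v]x) = v²≉-1 (*≈-⇒≈-1 x≉0 (begin
    v * v * x                ≡⟨ solve (v ∷ x ∷ []) ⟩
    - (v * (- v * x))        ≈⟨ -‿cong (*-congˡ v (≈-sym 1+x≈[-v]x)) ⟩
    - (v * (+ 1 + x))        ≈⟨ -‿cong (≈-sym x≈v[1+x]) ⟩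
    - x                      ∎))

  even-or-odd : ∀ w → ∃[ q ] (w ≡ q ℕ.+ q ⊎ w ≡ suc (q ℕ.+ q))
  even-or-odd zero = 0 , inj₁ refl
  even-or-odd (suc w) with even-or-odd w
  ... | q , inj₁ w≡2q   = q , inj₂ (cong suc w≡2q)
  ... | q , inj₂ w≡1+2q = suc q , inj₁ (cong suc (trans w≡1+2q (sym (+-suc q q))))

  odd-representative : ∀ {x} → ¬ x ≈ + 0 → ¬ x ≈± + 1 → ∃[ i ] (1 ≤ i × i < n × x ≈± + suc (i ℕ.+ i))
  odd-representative {x} x≉0 x≉±1 with residue x
  ... | w , w<p , x≈w with even-or-odd w
  ...   | q , inj₂ refl = q , n≢0⇒n>0 q≢0 , q<n , inj₁ x≈w
    where
    q≢0 : q ≢ 0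
    q≢0 refl = x≉±1 (inj₁ x≈w)
    q<n : q < n
    q<n = ≰⇒> (λ n≤q → <⇒≱ w<p (s≤s (+-mono-≤ n≤q (≤-trans (≤-reflexive (+-identityʳ n)) n≤q))))
  ...   | q , inj₁ refl = n ∸ q , m<n⇒0<n∸m q<n , ∸-monoʳ-< (n≢0⇒n>0 q≢0) (<⇒≤ q<n) , inj₂ x≈-[1+2[n∸q]]
    where
    q≢0 : q ≢ 0
    q≢0 refl = x≉0 x≈w
    q≤n : q ≤ n
    q≤n = ≮⇒≥ (λ n<q → <⇒≱ w<p (+-mono-≤ n<q (≤-trans (≤-reflexive (+-identityʳ n)) (<⇒≤ n<q))))
    q≢n : q ≢ n
    q≢n refl = x≉±1 (inj₂ (≈-trans x≈w (≈-trans (≡⇒≈ (cong (λ k → + (q ℕ.+ k)) (sym (+-identityʳ q)))) order≈-1)))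
    q<n : q < n
    q<n = ≤∧≢⇒< q≤n q≢n
    x≈-[1+2[n∸q]] : x ≈ - + suc ((n ∸ q) ℕ.+ (n ∸ q))
    x≈-[1+2[n∸q]] = ≈-trans x≈w (sum≡p⇒≈- (even+odd≡p {n ∸ q} (m∸n+n≡m q≤n)))

  EdgeMultiple : ℤ → ℕ → ℕ → Set
  EdgeMultiple w i j = (+ i ≈± w * + j × + suc i ≈± w * + suc j)
                     ⊎ (+ i ≈± w * + suc j × + suc i ≈± w * + j)

  EdgePair : ℤ → Set
  EdgePair w = ∃₂ λ i j → (1 ≤ i × i < n) × (1 ≤ j × j < n) × i ≢ j × EdgeMultiple w i j

  Vz≈-i⇒V[1+z]≈1+i : ∀ V I Z → V ≈ + 1 + (I + I) → V * Z ≈ - I → V * (+ 1 + Z) ≈ + 1 + I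
  Vz≈-i⇒V[1+z]≈1+i V I Z V≈1+2I VZ≈-I = begin
    V * (+ 1 + Z)            ≡⟨ solve (V ∷ Z ∷ []) ⟩
    V + V * Z                ≈⟨ +-cong V≈1+2I VZ≈-I ⟩
    + 1 + (I + I) + - I      ≡⟨ solve (I ∷ []) ⟩
    + 1 + I                  ∎

  1+2i≉0 : ∀ {i} → i < n → ¬ + suc (i ℕ.+ i) ≈ + 0
  1+2i≉0 i<n = +≉0 (s≤s z≤n) (s≤s (+-mono-≤ i<n (≤-trans (<⇒≤ i<n) (≤-reflexive (sym (+-identityʳ n))))))

  -- With V = 2i + 1 ≡ ±w and V z ≡ -i, also V (z + 1) ≡ i + 1; the edge pair is then
  -- (i, z) when z < n and (i, p - 1 - z) when n < z.
  module OddScaling {w} (w≉±1 : ¬ w ≈± + 1) (w²≉-1 : ¬ w * w ≈ - + 1)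
                    {i} (1≤i : 1 ≤ i) (i<n : i < n) (w≈±V : w ≈± + suc (i ℕ.+ i))
                    {z} (z<p : z < p) (Vz≈-i : + suc (i ℕ.+ i) * + z ≈ - + i) where

    V : ℤ
    V = + suc (i ℕ.+ i)

    i≉0 : ¬ + i ≈ + 0
    i≉0 = +≉0 1≤i (<-trans i<n n<p)

    scale : ∀ {a b} → a ≈± V * b → a ≈± w * b
    scale a≈±Vb = ≈±-trans a≈±Vb (≈±-*-cong (≈±-sym w≈±V) (inj₁ ≈-refl))

    V[1+z]≈1+i : V * + suc z ≈ + suc i
    V[1+z]≈1+i = Vz≈-i⇒V[1+z]≈1+i V (+ i) (+ z) ≈-refl Vz≈-i

    i≈-Vz : + i ≈ - (V * + z)
    i≈-Vz = ≈-trans (≡⇒≈ (sym (neg-involutive (+ i)))) (-‿cong (≈-sym Vz≈-i))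

    z≢0 : z ≢ 0
    z≢0 refl = i≉0 (≈-trans i≈-Vz (≡⇒≈ (cong -_ (*-zeroʳ V))))

    z≢order : z ≢ order
    z≢order refl = +≉0 (s≤s z≤n) (≤-<-trans i<n n<p)
      (≈-trans (≈-sym V[1+z]≈1+i) (≈-trans (*-congˡ V Q≈0) (≡⇒≈ (*-zeroʳ V))))

    z≢n : z ≢ n
    z≢n refl = 1≉0 (+-cancelʳ (+ i) (begin
      + 1 + + i          ≈⟨ ≈-sym V[1+z]≈1+i ⟩
      V * + suc n        ≈⟨ *-congˡ V 1+n≈-n ⟩
      V * - + n          ≡⟨ neg-distribʳ-* V (+ n) ⟨
      - (V * + n)        ≈⟨ ≈-sym i≈-Vz ⟩
      + i                ∎))

    pair-below : z < n → EdgePair w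
    pair-below z<n = i , z , (1≤i , i<n) , (n≢0⇒n>0 z≢0 , z<n) , i≢z ,
                     inj₁ (scale (inj₂ i≈-Vz) , scale (inj₁ (≈-sym V[1+z]≈1+i)))
      where
      i≢z : i ≢ z
      i≢z refl = w≉±1 (≈±-trans w≈±V (inj₂ (*≈-⇒≈-1 i≉0 Vz≈-i)))

    pair-above : n < z → EdgePair w
    pair-above n<z = i , j , (1≤i , i<n) , (m<n⇒0<n∸m z<order , order∸z<n n<z z≤order) , i≢j ,
                     inj₂ (scale (inj₁ i≈V[1+j]) , scale (inj₂ 1+i≈-Vj))
      where
      z≤order : z ≤ order
      z≤order = s≤s⁻¹ z<p
      z<order : z < order
      z<order = ≤∧≢⇒< z≤order z≢order
      j : ℕ
      j = order ∸ z
      i≈V[1+j] : + i ≈ V * + suc j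
      i≈V[1+j] = begin
        + i                ≈⟨ i≈-Vz ⟩
        - (V * + z)        ≡⟨ neg-distribʳ-* V (+ z) ⟩
        V * - + z          ≈⟨ *-congˡ V (≈-sym (reflect-suc z≤order)) ⟩
        V * + suc j        ∎
      1+i≈-Vj : + suc i ≈ - (V * + j)
      1+i≈-Vj = begin
        + suc i            ≈⟨ ≈-sym V[1+z]≈1+i ⟩
        V * + suc z        ≡⟨ neg-involutive (V * + suc z) ⟨
        - - (V * + suc z)  ≡⟨ cong -_ (neg-distribʳ-* V (+ suc z)) ⟩
        - (V * - + suc z)  ≈⟨ -‿cong (*-congˡ V (≈-sym (reflect z≤order))) ⟩
        - (V * + j)        ∎
      i≢j : i ≢ j
      i≢j i≡j = w²≉-1 (≈-trans (≈±-square w≈±V) (*≈-⇒≈-1 i≉0 (begin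
        V * V * + i          ≡⟨ *-assoc V V (+ i) ⟩
        V * (V * + i)        ≈⟨ *-congˡ V Vi≈-[1+i] ⟩
        V * - + suc i        ≡⟨ neg-distribʳ-* V (+ suc i) ⟨
        - (V * + suc i)      ≈⟨ -‿cong V[1+i]≈i ⟩
        - + i                ∎)))
        where
        V[1+i]≈i : V * + suc i ≈ + i
        V[1+i]≈i = ≈-sym (subst (λ k → + i ≈ V * + suc k) (sym i≡j) i≈V[1+j])
        Vi≈-[1+i] : V * + i ≈ - + suc i
        Vi≈-[1+i] = ≈-trans (≡⇒≈ (sym (neg-involutive (V * + i))))
                            (-‿cong (≈-sym (subst (λ k → + suc i ≈ - (V * + k)) (sym i≡j) 1+i≈-Vj)))

    pair : Tri (z < n) (z ≡ n) (n < z) → EdgePair w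
    pair (tri< z<n _ _) = pair-below z<n
    pair (tri≈ _ z≡n _) = contradiction z≡n z≢n
    pair (tri> _ _ n<z) = pair-above n<z

  edge-pair : ∀ {w} → ¬ w ≈ + 0 → ¬ w ≈± + 1 → ¬ w * w ≈ - + 1 → EdgePair w
  edge-pair {w} w≉0 w≉±1 w²≉-1 = from-representative (odd-representative w≉0 w≉±1)
    where
    from-representative : ∃[ i ] (1 ≤ i × i < n × w ≈± + suc (i ℕ.+ i)) → EdgePair w
    from-representative (i , 1≤i , i<n , w≈±V) = from-root (linear-solution (1+2i≉0 i<n) (- + i))
      where
      from-root : ∃[ z ] (z < p × + suc (i ℕ.+ i) * + z ≈ - + i) → EdgePair w
      from-root (z , z<p , Vz≈-i) = OddScaling.pair {w} w≉±1 w²≉-1 {i} 1≤i i<n w≈±V {z} z<p Vz≈-i (<-cmp z n)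

module PrimitiveRootPowers (n g : ℕ) .{{_ : NonZero n}}
                           (prime : Prime (suc (2 ℕ.* n)))
                           (root : PrimitiveRoot (suc (2 ℕ.* n)) g) where
  open import Data.Integer.Base using (-_; _+_; _*_)
  open import Data.Integer.Properties using (pos-*; -1*i≡-i; *-identityʳ; *-zeroˡ)
  open import Data.Nat.Base using (zero; _∸_; _≤_; _<_; _^_)
  open import Data.Nat.Divisibility using (_∣_; divides)
  open import Data.Nat.DivMod using (_%_; _/_; m%n<n; m≡m%n+[m/n]*n; m∣n⇒o%n%m≡o%m)
  open import Data.Nat.Properties
    using (^-distribˡ-+-*; +-identityʳ; ≤-trans; ≤-<-trans; <⇒≤; <-cmp; m+[n∸m]≡n; m∸n≤m; m<n⇒0<n∸m)
  open import Data.Product.Base using (proj₁; proj₂)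
  open import Data.Sum.Base using (inj₁; inj₂)
  open import Relation.Binary.Definitions using (tri<; tri≈; tri>)
  open import Relation.Binary.PropositionalEquality
  open import Relation.Nullary using (¬_; contradiction)

  open HalfSystem n public
  open PrimeField p prime public
  module ℤₙ = Residues n
  open ≈-Reasoning

  G : ℕ → ℤ
  G e = + (g ^ e)

  G-+ : ∀ a b → G (a ℕ.+ b) ≡ G a * G b
  G-+ a b = trans (cong +_ (^-distribˡ-+-* g a b)) (pos-* (g ^ a) (g ^ b))

  G[order]≈1 : G order ≈ + 1
  G[order]≈1 = %≡⇒≈ (proj₁ root)

  G≉1 : ∀ {k} → 1 ≤ k → k < order → ¬ G k ≈ + 1
  G≉1 1≤k k<order Gk≈1 = proj₂ root _ 1≤k k<order (≈⇒%≡ Gk≈1)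

  G≉0 : ∀ e → ¬ G e ≈ + 0
  G≉0 zero    = 1≉0
  G≉0 (suc e) G[1+e]≈0 = *-≉0 G1≉0 (G≉0 e) (≈-trans (≡⇒≈ (sym (G-+ 1 e))) G[1+e]≈0)
    where
    G1≉0 : ¬ G 1 ≈ + 0
    G1≉0 G1≈0 = 1≉0 (begin
      + 1                          ≈⟨ ≈-sym G[order]≈1 ⟩
      G order                      ≡⟨ cong G (m+[n∸m]≡n (≤-trans 1≤n (<⇒≤ n<order))) ⟨
      G (1 ℕ.+ (order ∸ 1))        ≡⟨ G-+ 1 (order ∸ 1) ⟩
      G 1 * G (order ∸ 1)          ≈⟨ *-congʳ _ G1≈0 ⟩
      + 0 * G (order ∸ 1)          ≡⟨ *-zeroˡ (G (order ∸ 1)) ⟩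
      + 0                          ∎)

  G[n]²≈1 : G n * G n ≈ + 1
  G[n]²≈1 = begin
    G n * G n          ≡⟨ G-+ n n ⟨
    G (n ℕ.+ n)        ≡⟨ cong (λ k → G (n ℕ.+ k)) (+-identityʳ n) ⟨
    G order            ≈⟨ G[order]≈1 ⟩
    + 1                ∎

  G[n]≈-1 : G n ≈ - + 1
  G[n]≈-1 with square≈1 G[n]²≈1
  ... | inj₁ Gn≈1  = contradiction Gn≈1 (G≉1 1≤n n<order)
  ... | inj₂ Gn≈-1 = Gn≈-1

  G[j*order]≈1 : ∀ j → G (j ℕ.* order) ≈ + 1
  G[j*order]≈1 zero    = ≈-refl
  G[j*order]≈1 (suc j) = ≈-trans (≡⇒≈ (G-+ order (j ℕ.* order))) (*-cong G[order]≈1 (G[j*order]≈1 j))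

  G[j*n]≈±1 : ∀ j → G (j ℕ.* n) ≈± + 1
  G[j*n]≈±1 zero    = inj₁ ≈-refl
  G[j*n]≈±1 (suc j) =
    ≈±-trans (inj₁ (≡⇒≈ (G-+ n (j ℕ.* n)))) (≈±-*-cong (inj₂ G[n]≈-1) (G[j*n]≈±1 j))

  G-mod-order : ∀ a → G a ≈ G (a % order)
  G-mod-order a = begin
    G a                                          ≡⟨ cong G (m≡m%n+[m/n]*n a order) ⟩
    G (a % order ℕ.+ a / order ℕ.* order)        ≡⟨ G-+ (a % order) _ ⟩
    G (a % order) * G (a / order ℕ.* order)      ≈⟨ *-congˡ (G (a % order)) (G[j*order]≈1 (a / order)) ⟩
    G (a % order) * + 1                          ≡⟨ *-identityʳ (G (a % order)) ⟩
    G (a % order)                                ∎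

  G-mod-n : ∀ a → G a ≈± G (a % n)
  G-mod-n a = ≈±-trans (inj₁ (begin
    G a                              ≡⟨ cong G (m≡m%n+[m/n]*n a n) ⟩
    G (a % n ℕ.+ a / n ℕ.* n)        ≡⟨ G-+ (a % n) (a / n ℕ.* n) ⟩
    G (a % n) * G (a / n ℕ.* n)      ∎))
    (≈±-trans (≈±-*-cong (inj₁ (≈-refl {G (a % n)})) (G[j*n]≈±1 (a / n)))
              (inj₁ (≡⇒≈ (*-identityʳ (G (a % n))))))

  G≉G : ∀ {r s} → r < s → s < order → ¬ G r ≈ G s
  G≉G {r} {s} r<s s<order Gr≈Gs = G≉1 (m<n⇒0<n∸m r<s) (≤-<-trans (m∸n≤m s r) s<order)
    (≈-sym (*-cancelˡ (G≉0 r) (begin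
      G r * + 1            ≡⟨ *-identityʳ (G r) ⟩
      G r                  ≈⟨ Gr≈Gs ⟩
      G s                  ≡⟨ cong G (m+[n∸m]≡n (<⇒≤ r<s)) ⟨
      G (r ℕ.+ (s ∸ r))    ≡⟨ G-+ r (s ∸ r) ⟩
      G r * G (s ∸ r)      ∎)))

  G-injective : ∀ {r s} → r < order → s < order → G r ≈ G s → r ≡ s
  G-injective {r} {s} r<order s<order Gr≈Gs with <-cmp r s
  ... | tri< r<s _ _ = contradiction Gr≈Gs (G≉G r<s s<order)
  ... | tri≈ _ r≡s _ = r≡s
  ... | tri> _ _ s<r = contradiction (≈-sym Gr≈Gs) (G≉G s<r r<order)

  G≈G⇒≈ₙ : ∀ {a b} → G a ≈ G b → + a ℤₙ.≈ + b
  G≈G⇒≈ₙ {a} {b} Ga≈Gb =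
    ℤₙ.%≡⇒≈ (trans (sym (%order%n a)) (trans (cong (_% n) a%order≡b%order) (%order%n b)))
    where
    n∣order : n ∣ order
    n∣order = divides 2 refl
    %order%n : ∀ x → x % order % n ≡ x % n
    %order%n x = m∣n⇒o%n%m≡o%m n order x n∣order
    a%order≡b%order : a % order ≡ b % order
    a%order≡b%order = G-injective (m%n<n a order) (m%n<n b order)
      (≈-trans (≈-sym (G-mod-order a)) (≈-trans Ga≈Gb (G-mod-order b)))

  G≈±G⇒≈ₙ : ∀ {a b} → G a ≈± G b → + a ℤₙ.≈ + b
  G≈±G⇒≈ₙ (inj₁ Ga≈Gb) = G≈G⇒≈ₙ Ga≈Gb
  G≈±G⇒≈ₙ {a} {b} (inj₂ Ga≈-Gb) = ℤₙ.≈-trans (G≈G⇒≈ₙ Ga≈G[n+b]) (ℤₙ.+-cong ℤₙ.Q≈0 (ℤₙ.≈-refl {+ b}))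
    where
    Ga≈G[n+b] : G a ≈ G (n ℕ.+ b)
    Ga≈G[n+b] = begin
      G a             ≈⟨ Ga≈-Gb ⟩
      - G b           ≡⟨ -1*i≡-i (G b) ⟨
      - + 1 * G b     ≈⟨ *-congʳ (G b) (≈-sym G[n]≈-1) ⟩
      G n * G b       ≡⟨ G-+ n b ⟨
      G (n ℕ.+ b)     ∎

  ≈ₙ⇒G≈±G : ∀ {a b} → + a ℤₙ.≈ + b → G a ≈± G b
  ≈ₙ⇒G≈±G {a} {b} a≈b =
    ≈±-trans (G-mod-n a) (subst (λ r → G r ≈± G b) (sym (ℤₙ.≈⇒%≡ a≈b)) (≈±-sym (G-mod-n b)))

  G≉±1 : ∀ {k} → 1 ≤ k → k < n → ¬ G k ≈± + 1
  G≉±1 1≤k k<n Gk≈±1 = ℤₙ.+≉0 1≤k k<n (G≈±G⇒≈ₙ Gk≈±1)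

module CyclicDifferences (m : ℕ) where
  open import Data.Bool.Base using (T)
  open import Data.Bool.Properties using (T-∨)
  open import Data.Integer.Base using (_+_)
  import Data.Integer.Properties as ℤP
  open import Data.Nat.Base using (_∸_; _≤_; _<_; s≤s)
  open import Data.Nat.DivMod using (m%n<n)
  open import Data.Nat.Properties
    using (_≤?_; ≤-<-trans; <⇒≤; ≰⇒>; n≢0⇒n>0; m<n⇒0<n∸m; ∸-monoʳ-≤; ∸-monoʳ-<; +-assoc; +-identityʳ; m≤m+n;
           m+n∸m≡n; m∸n+n≡m; m+[n∸m]≡n; ≡ᵇ⇒≡; ≡⇒≡ᵇ)
  open import Data.Product.Base using (∃-syntax; _×_; _,_)
  open import Data.Sum.Base as Sum using (inj₁; inj₂)
  open import Function.Base using (_∘_)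
  open import Function.Bundles using (_⇔_; mk⇔; Equivalence)
  open import Relation.Binary.PropositionalEquality
  open import Relation.Nullary using (Dec; yes; no)
  open import Defs using (N; dif; shiftDown; isLen; HasLen; DistIs)

  n : ℕ
  n = N m

  open Residues n public
  open ≈-Reasoning

  dif+x≈y : ∀ {x} y → x ≤ n → + dif m x y + + x ≈ + y
  dif+x≈y {x} y x≤n = begin
    + dif m x y + + x          ≈⟨ +-cong (≈-sym (≈-% (y ℕ.+ (n ∸ x)))) (≈-refl {+ x}) ⟩
    + (y ℕ.+ (n ∸ x) ℕ.+ x)    ≡⟨ cong +_ (trans (+-assoc y (n ∸ x) x) (cong (y ℕ.+_) (m∸n+n≡m x≤n))) ⟩
    + y + + n                  ≈⟨ +-cong (≈-refl {+ y}) Q≈0 ⟩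
    + y + + 0                  ≡⟨ ℤP.+-identityʳ (+ y) ⟩
    + y                        ∎

  dif≡⇒≈ : ∀ {x y r} → x ≤ n → dif m x y ≡ r → + y ≈ + x + + r
  dif≡⇒≈ {x} {y} x≤n refl = ≈-trans (≈-sym (dif+x≈y y x≤n)) (≡⇒≈ (ℤP.+-comm (+ dif m x y) (+ x)))

  ≈⇒dif≡ : ∀ {x y r} → x ≤ n → r < n → + y ≈ + x + + r → dif m x y ≡ r
  ≈⇒dif≡ {x} {y} {r} x≤n r<n y≈x+r = residue-unique (m%n<n (y ℕ.+ (n ∸ x)) n) r<n (+-cancelʳ (+ x) (begin
    + dif m x y + + x      ≈⟨ dif+x≈y y x≤n ⟩
    + y                    ≈⟨ y≈x+r ⟩
    + x + + r              ≡⟨ ℤP.+-comm (+ x) (+ r) ⟩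
    + r + + x              ∎))

  HasLen⇔DiffersBy : ∀ {x y ℓ} → x ≤ n → y ≤ n → ℓ < n → HasLen m x y ℓ ⇔ DiffersBy (+ x) (+ y) (+ ℓ)
  HasLen⇔DiffersBy x≤n y≤n ℓ<n =
    mk⇔ (Sum.map (dif≡⇒≈ x≤n) (dif≡⇒≈ y≤n)) (Sum.map (≈⇒dif≡ x≤n ℓ<n) (≈⇒dif≡ y≤n ℓ<n))

  T-isLen⇔HasLen : ∀ {x y ℓ} → T (isLen m x y ℓ) ⇔ HasLen m x y ℓ
  T-isLen⇔HasLen {ℓ = ℓ} = mk⇔
    (Sum.map (≡ᵇ⇒≡ _ ℓ) (≡ᵇ⇒≡ _ ℓ) ∘ Equivalence.to T-∨)
    (Equivalence.from T-∨ ∘ Sum.map (≡⇒≡ᵇ _ ℓ) (≡⇒≡ᵇ _ ℓ))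

  edge-length : ∀ {x y} → x < n → y < n → x ≢ y → ∃[ ℓ ] (1 ≤ ℓ × ℓ ≤ m × HasLen m x y ℓ)
  edge-length {x} {y} x<n y<n x≢y = choose (δ ≤? m)
    where
    δ : ℕ
    δ = dif m x y
    δ<n : δ < n
    δ<n = m%n<n (y ℕ.+ (n ∸ x)) n
    y≈x+δ : + y ≈ + x + + δ
    y≈x+δ = dif≡⇒≈ (<⇒≤ x<n) refl
    δ≢0 : δ ≢ 0
    δ≢0 δ≡0 = x≢y (sym (residue-unique y<n x<n
      (≈-trans y≈x+δ (≡⇒≈ (trans (cong (λ r → + x + + r) δ≡0) (ℤP.+-identityʳ (+ x)))))))
    x≈y+[n∸δ] : + x ≈ + y + + (n ∸ δ)
    x≈y+[n∸δ] = begin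
      + x                        ≡⟨ ℤP.+-identityʳ (+ x) ⟨
      + x + + 0                  ≈⟨ +-cong (≈-refl {+ x}) (≈-sym Q≈0) ⟩
      + (x ℕ.+ n)                ≡⟨ cong (λ k → + (x ℕ.+ k)) (m+[n∸m]≡n (<⇒≤ δ<n)) ⟨
      + (x ℕ.+ (δ ℕ.+ (n ∸ δ)))  ≡⟨ cong +_ (+-assoc x δ (n ∸ δ)) ⟨
      + x + + δ + + (n ∸ δ)      ≈⟨ +-cong (≈-sym y≈x+δ) (≈-refl {+ (n ∸ δ)}) ⟩
      + y + + (n ∸ δ)            ∎
    n∸[1+m]≡m : n ∸ suc m ≡ m
    n∸[1+m]≡m = trans (m+n∸m≡n m (m ℕ.+ 0)) (+-identityʳ m)
    choose : Dec (δ ≤ m) → ∃[ ℓ ] (1 ≤ ℓ × ℓ ≤ m × HasLen m x y ℓ)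
    choose (yes δ≤m) = δ , n≢0⇒n>0 δ≢0 , δ≤m , inj₁ refl
    choose (no  δ≰m) = n ∸ δ , m<n⇒0<n∸m δ<n , subst (n ∸ δ ≤_) n∸[1+m]≡m (∸-monoʳ-≤ n (≰⇒> δ≰m))
                     , inj₂ (≈⇒dif≡ (<⇒≤ y<n) (∸-monoʳ-< (n≢0⇒n>0 δ≢0) (<⇒≤ δ<n)) x≈y+[n∸δ])

  shiftDown≡ : ∀ {k x x′} → k ≤ n → x′ < n → + x ≈ + x′ + + k → shiftDown m k x ≡ x′
  shiftDown≡ {k} {x} {x′} k≤n x′<n x≈x′+k = ≈⇒dif≡ k≤n x′<n (≈-trans x≈x′+k (≡⇒≈ (ℤP.+-comm (+ x′) (+ k))))

  shifted⇒DistIs : ∀ {k x y x′ y′} → k ≤ n → x′ < n → y′ < n →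
                   ShiftedBy (+ k) (+ x) (+ y) (+ x′) (+ y′) → DistIs m k x y x′ y′
  shifted⇒DistIs k≤n x′<n y′<n (inj₁ (x≈x′+k , y≈y′+k)) =
    inj₂ (inj₁ (shiftDown≡ k≤n x′<n x≈x′+k , shiftDown≡ k≤n y′<n y≈y′+k))
  shifted⇒DistIs k≤n x′<n y′<n (inj₂ (x≈y′+k , y≈x′+k)) =
    inj₂ (inj₂ (shiftDown≡ k≤n y′<n x≈y′+k , shiftDown≡ k≤n x′<n y≈x′+k))

  m<n : m < n
  m<n = s≤s (m≤m+n m (m ℕ.+ 0))

  DistanceWitness : (ℕ → ℕ) → ℕ → Set
  DistanceWitness h k = ∃[ ℓ ] ∃[ s ] ∃[ t ]
    (1 ≤ ℓ × ℓ ≤ m × s < 2 ℕ.* m × t < 2 ℕ.* m × s ≢ t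
     × HasLen m (h s) (h (suc s)) ℓ × HasLen m (h t) (h (suc t)) ℓ
     × DistIs m k (h s) (h (suc s)) (h t) (h (suc t)))

  translated-edges⇒distance : ∀ h {k s t} → (∀ u → h u < n) → k ≤ m →
    s < 2 ℕ.* m → t < 2 ℕ.* m → s ≢ t → h s ≢ h (suc s) →
    ShiftedBy (+ k) (+ h s) (+ h (suc s)) (+ h t) (+ h (suc t)) → DistanceWitness h k
  translated-edges⇒distance h {k} {s} {t} h<n k≤m s<2m t<2m s≢t hs≢hs′ shifted
    with edge-length (h<n s) (h<n (suc s)) hs≢hs′
  ... | ℓ , 1≤ℓ , ℓ≤m , length-s =
    ℓ , s , t , 1≤ℓ , ℓ≤m , s<2m , t<2m , s≢t , length-s , length-t ,
    shifted⇒DistIs (<⇒≤ (≤-<-trans k≤m m<n)) (h<n t) (h<n (suc t)) shifted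
    where
    HasLen⇔ : ∀ u → HasLen m (h u) (h (suc u)) ℓ ⇔ DiffersBy (+ h u) (+ h (suc u)) (+ ℓ)
    HasLen⇔ u = HasLen⇔DiffersBy (<⇒≤ (h<n u)) (<⇒≤ (h<n (suc u))) (≤-<-trans ℓ≤m m<n)
    length-t : HasLen m (h t) (h (suc t)) ℓ
    length-t = Equivalence.from (HasLen⇔ t)
      (differsBy-shifted {k = + k} {l = + ℓ} shifted (Equivalence.to (HasLen⇔ s) length-s))

module LogarithmSequence (m g : ℕ) (c : ℕ → ℕ)
                         (prime : Prime (suc (2 ℕ.* N m)))
                         (root : PrimitiveRoot (suc (2 ℕ.* N m)) g)
                         (log : ∀ i → 1 ≤ i → i ≤ N m → c i < 2 ℕ.* N m × (g ^ c i) % suc (2 ℕ.* N m) ≡ i)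
                         where
  open import Data.Bool.Base using (Bool; T)
  open import Data.Integer.Base using (-_; _+_; _*_)
  import Data.Integer.Properties as ℤP
  open import Data.Nat.Base using (s≤s; s≤s⁻¹; z≤n)
  open import Data.Nat.DivMod using (m%n<n; m%n≤n; m<n⇒m%n≡m)
  open import Data.Nat.Properties
    using (≤-trans; <-trans; ≤-<-trans; <⇒≤; +-mono-≤; m≤m+n; suc-injective; n<1+n; <⇒≢)
  open import Data.Product.Base using (∃-syntax; _,_; proj₂)
  open import Function.Base using (_∘_)
  open import Data.Sum.Base as Sum using (_⊎_; inj₁; inj₂)
  open import Function.Bundles using (_⇔_; mk⇔; Equivalence)
  open import Function.Construct.Composition using (_⇔-∘_)
  open import Relation.Binary.PropositionalEquality
  open import Relation.Nullary using (¬_)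
  open import Defs using (count; isLen; HasLen; Arrangement)
  open Counting using (count-two)
  open PrimitiveRootPowers (N m) g prime root
  open SuccessorRatios (N m) prime
    using (SuccRatio; UniqueSuccRatio; SuccRatio-unique; SuccRatio-disjoint; ≈±-ratios⇔SuccRatio;
           EdgeMultiple; EdgePair; edge-pair)
  open CyclicDifferences m
    using (m<n; HasLen⇔DiffersBy; T-isLen⇔HasLen; DistanceWitness; translated-edges⇒distance)

  n : ℕ
  n = N m

  d : ℕ → ℕ
  d i = c i % n

  h : ℕ → ℕ
  h t = d (suc t)

  InRange : ℕ → Set
  InRange i = 1 ≤ i × i ≤ n

  G∘c : ∀ {i} → InRange i → G (c i) ≈ + i
  G∘c {i} (1≤i , i≤n) = ≈-trans (≈-% (g ^ c i)) (≡⇒≈ (cong +_ (proj₂ (log i 1≤i i≤n))))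

  LogDiff : ℕ → ℕ → ℕ → Set
  LogDiff a b e = + d a ℤₙ.≈ + d b + + e

  LogDiff⇔ : ∀ {a b e} → InRange a → InRange b → LogDiff a b e ⇔ (+ a ≈± G e * + b)
  LogDiff⇔ {a} {b} {e} a∈ b∈ = mk⇔ to from
    where
    G[cb+e]≈Ge·b : G (c b ℕ.+ e) ≈ G e * + b
    G[cb+e]≈Ge·b = ≈-trans (≡⇒≈ (G-+ (c b) e)) (≈-trans (*-congʳ (G e) (G∘c b∈)) (≡⇒≈ (ℤP.*-comm (+ b) (G e))))
    d≈c : ∀ x → + d x ℤₙ.≈ + c x
    d≈c x = ℤₙ.≈-sym (ℤₙ.≈-% (c x))
    to : LogDiff a b e → + a ≈± G e * + b
    to da≈db+e =
      ≈±-trans (inj₁ (≈-sym (G∘c a∈))) (≈±-trans (≈ₙ⇒G≈±G {c a} {c b ℕ.+ e} ca≈cb+e) (inj₁ G[cb+e]≈Ge·b))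
      where
      ca≈cb+e : + c a ℤₙ.≈ + c b + + e
      ca≈cb+e = ℤₙ.≈-trans (ℤₙ.≈-sym (d≈c a)) (ℤₙ.≈-trans da≈db+e (ℤₙ.+-cong (d≈c b) (ℤₙ.≈-refl {+ e})))
    from : + a ≈± G e * + b → LogDiff a b e
    from a≈±Ge·b = ℤₙ.≈-trans (d≈c a) (ℤₙ.≈-trans ca≈cb+e (ℤₙ.+-cong (ℤₙ.≈-sym (d≈c b)) (ℤₙ.≈-refl {+ e})))
      where
      ca≈cb+e : + c a ℤₙ.≈ + c b + + e
      ca≈cb+e = G≈±G⇒≈ₙ {c a} {c b ℕ.+ e}
        (≈±-trans (inj₁ (G∘c a∈)) (≈±-trans a≈±Ge·b (inj₁ (≈-sym G[cb+e]≈Ge·b))))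

  d-injective : ∀ {a b} → InRange a → InRange b → d a ≡ d b → a ≡ b
  d-injective {a} {b} a∈@(1≤a , a≤n) b∈@(1≤b , b≤n) da≡db = ≈±-injective 1≤a a≤n 1≤b b≤n
    (≈±-trans (Equivalence.to (LogDiff⇔ {e = 0} a∈ b∈) da≈db+0) (inj₁ (≡⇒≈ (ℤP.*-identityˡ (+ b)))))
    where
    da≈db+0 : LogDiff a b 0
    da≈db+0 = ℤₙ.≡⇒≈ (trans (cong +_ da≡db) (sym (ℤP.+-identityʳ (+ d b))))

  d-surjective : ∀ {x} → x < n → ∃[ a ] (InRange a × d a ≡ x)
  d-surjective {x} x<n with ≈±-representative (G≉0 x)
  ... | a , 1≤a , a≤n , Gx≈±a =
    a , (1≤a , a≤n) ,
    trans (ℤₙ.≈⇒%≡ (G≈±G⇒≈ₙ {c a} {x} (≈±-trans (inj₁ (G∘c (1≤a , a≤n))) (≈±-sym Gx≈±a)))) (m<n⇒m%n≡m x<n)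

  h-injective : ∀ s t → s < n → t < n → h s ≡ h t → s ≡ t
  h-injective s t s<n t<n hs≡ht = suc-injective (d-injective (s≤s z≤n , s<n) (s≤s z≤n , t<n) hs≡ht)

  h-surjective : ∀ x → x < n → ∃[ t ] (t < n × h t ≡ x)
  h-surjective x x<n = shift (d-surjective x<n)
    where
    shift : ∃[ a ] (InRange a × d a ≡ x) → ∃[ t ] (t < n × h t ≡ x)
    shift (suc t , (_ , t<n) , dt≡x) = t , t<n , dt≡x

  arrangement : Arrangement m h
  arrangement = (λ t _ → m%n<n (c (suc t)) n) , h-surjective , h-injective

  edge⇔SuccRatio : ∀ {t ℓ} → t < 2 ℕ.* m → ℓ < n →
               HasLen m (h t) (h (suc t)) ℓ ⇔ (SuccRatio (G ℓ) (+ suc t) ⊎ SuccRatio (- G ℓ) (+ suc t))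
  edge⇔SuccRatio {t} {ℓ} t<2m ℓ<n =
    ≈±-ratios⇔SuccRatio {G ℓ} {+ suc t} ⇔-∘ (ratios ⇔-∘
      HasLen⇔DiffersBy (m%n≤n (c (suc t)) n) (m%n≤n (c (suc (suc t))) n) ℓ<n)
    where
    i∈ : InRange (suc t)
    i∈ = s≤s z≤n , s≤s (<⇒≤ t<2m)
    i+1∈ : InRange (suc (suc t))
    i+1∈ = s≤s z≤n , s≤s t<2m
    ratios : (LogDiff (suc (suc t)) (suc t) ℓ ⊎ LogDiff (suc t) (suc (suc t)) ℓ)
             ⇔ (+ suc (suc t) ≈± G ℓ * + suc t ⊎ + suc t ≈± G ℓ * + suc (suc t))
    ratios = mk⇔ (Sum.map (Equivalence.to (LogDiff⇔ i+1∈ i∈)) (Equivalence.to (LogDiff⇔ i∈ i+1∈)))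
                 (Sum.map (Equivalence.from (LogDiff⇔ i+1∈ i∈)) (Equivalence.from (LogDiff⇔ i∈ i+1∈)))

  EdgePosition : ℤ → Set
  EdgePosition v = ∃[ a ] (a < 2 ℕ.* m × SuccRatio v (+ suc a)
                           × (∀ {t} → t < 2 ℕ.* m → SuccRatio v (+ suc t) → t ≡ a))

  edge-position : ∀ {v} → ¬ v ≈ + 0 → ¬ v ≈± + 1 → EdgePosition v
  edge-position {v} v≉0 v≉±1 = shift (SuccRatio-unique v≉0 v≉±1)
    where
    shift : UniqueSuccRatio v → EdgePosition v
    shift (suc a , ((_ , 1+a<n) , ratio) , unique) =
      a , s≤s⁻¹ 1+a<n , ratio , λ t<2m ratio-t → suc-injective (sym (unique ((s≤s z≤n , s≤s t<2m) , ratio-t)))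

  G²≉-1 : ∀ {k} → 1 ≤ k → k ≤ m → ¬ G k * G k ≈ - + 1
  G²≉-1 {k} 1≤k k≤m Gk²≈-1 =
    G≉±1 (≤-trans 1≤k (m≤m+n k k)) (s≤s (+-mono-≤ k≤m (≤-trans k≤m (m≤m+n m 0))))
         (inj₂ (≈-trans (≡⇒≈ (G-+ k k)) Gk²≈-1))

  terrace-count : ∀ ℓ → 1 ≤ ℓ → ℓ ≤ m → count (λ t → isLen m (h t) (h (suc t)) ℓ) (2 ℕ.* m) ≡ 2
  terrace-count ℓ 1≤ℓ ℓ≤m = from-positions (edge-position u≉0 u≉±1) (edge-position -u≉0 -u≉±1)
    where
    u : ℤ
    u = G ℓ
    ℓ<n : ℓ < n
    ℓ<n = ≤-<-trans ℓ≤m m<n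
    u≉0 : ¬ u ≈ + 0
    u≉0 = G≉0 ℓ
    u≉±1 : ¬ u ≈± + 1
    u≉±1 = G≉±1 1≤ℓ ℓ<n
    u≈-[-u] : u ≈ - - u
    u≈-[-u] = ≡⇒≈ (sym (ℤP.neg-involutive u))
    -u≉0 : ¬ - u ≈ + 0
    -u≉0 -u≈0 = u≉0 (≈-trans u≈-[-u] (-‿cong -u≈0))
    -u≉±1 : ¬ - u ≈± + 1
    -u≉±1 -u≈±1 = u≉±1 (≈±-trans (inj₂ u≈-[-u]) -u≈±1)
    P : ℕ → Bool
    P t = isLen m (h t) (h (suc t)) ℓ
    P⇔ : ∀ {t} → t < 2 ℕ.* m → T (P t) ⇔ (SuccRatio u (+ suc t) ⊎ SuccRatio (- u) (+ suc t))
    P⇔ {t} t<2m = edge⇔SuccRatio t<2m ℓ<n ⇔-∘ T-isLen⇔HasLen {h t} {h (suc t)}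
    from-positions : EdgePosition u → EdgePosition (- u) → count P (2 ℕ.* m) ≡ 2
    from-positions (a , a<2m , ratio-a , only-a) (b , b<2m , ratio-b , only-b) =
      count-two P a≢b a<2m b<2m (Equivalence.from (P⇔ a<2m) (inj₁ ratio-a)) (Equivalence.from (P⇔ b<2m) (inj₂ ratio-b))
        (λ t t<2m Pt → Sum.map (only-a t<2m) (only-b t<2m) (Equivalence.to (P⇔ t<2m) Pt))
      where
      a≢b : a ≢ b
      a≢b refl = SuccRatio-disjoint u≉0 (G²≉-1 1≤ℓ ℓ≤m)
        (+≉0 (s≤s z≤n) (<-trans (s≤s a<2m) n<p)) (+≉0 (s≤s z≤n) (≤-<-trans (s≤s a<2m) n<p)) ratio-a ratio-b

  distance-witness : ∀ k → 1 ≤ k → k ≤ m → DistanceWitness h k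
  distance-witness k 1≤k k≤m = from-pair (edge-pair (G≉0 k) (G≉±1 1≤k (≤-<-trans k≤m m<n)) (G²≉-1 1≤k k≤m))
    where
    from-pair : EdgePair (G k) → DistanceWitness h k
    from-pair (suc s , suc t , (_ , 1+s<n) , (_ , 1+t<n) , 1+s≢1+t , translate) =
      translated-edges⇒distance h (λ u → m%n<n (c (suc u)) n) k≤m (s≤s⁻¹ 1+s<n) (s≤s⁻¹ 1+t<n)
        (1+s≢1+t ∘ cong suc) hs≢hs+1 (shifted translate)
      where
      s∈ : InRange (suc s)
      s∈ = s≤s z≤n , <⇒≤ 1+s<n
      s+1∈ : InRange (suc (suc s))
      s+1∈ = s≤s z≤n , 1+s<n
      t∈ : InRange (suc t)
      t∈ = s≤s z≤n , <⇒≤ 1+t<n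
      t+1∈ : InRange (suc (suc t))
      t+1∈ = s≤s z≤n , 1+t<n
      hs≢hs+1 : h s ≢ h (suc s)
      hs≢hs+1 hs≡hs+1 = <⇒≢ (n<1+n (suc s)) (d-injective s∈ s+1∈ hs≡hs+1)
      logDiff : ∀ {a b} → InRange a → InRange b → + a ≈± G k * + b → LogDiff a b k
      logDiff a∈ b∈ = Equivalence.from (LogDiff⇔ a∈ b∈)
      shifted : EdgeMultiple (G k) (suc s) (suc t) →
                ℤₙ.ShiftedBy (+ k) (+ h s) (+ h (suc s)) (+ h t) (+ h (suc t))
      shifted (inj₁ (s≈t , s+1≈t+1)) = inj₁ (logDiff s∈ t∈ s≈t , logDiff s+1∈ t+1∈ s+1≈t+1)
      shifted (inj₂ (s≈t+1 , s+1≈t)) = inj₂ (logDiff s∈ t+1∈ s≈t+1 , logDiff s+1∈ t∈ s+1≈t)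

open import Data.Nat using (_*_)

theorem2p4 : (m g : ℕ) (c : ℕ → ℕ) →
    Prime (suc (2 * N m)) →
    PrimitiveRoot (suc (2 * N m)) g →
    (∀ i → 1 ≤ i → i ≤ N m → c i < 2 * N m × (g ^ c i) % suc (2 * N m) ≡ i) →
    ODCStarter m (λ t → c (suc t) % N m)
theorem2p4 m g c prime root log = (arrangement , terrace-count) , distance-witness
  where open LogarithmSequence m g c prime root log
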